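{- Consider the dynamic algorithm and counters described in the context, run on any sequence of $T$ hyperedge insertions/deletions starting from the empty hypergraph. Then $I^{down}\le \frac{f}{\alpha-1}\,(T+C^{up})$.
   Context: Setting: hypergraph $\mathcal{G}=(V,E)$ on a fixed node set with $|V|=n$, every hyperedge containing at most $f$ nodes, initially $E=\emptyset$, subject to a sequence of $T$ hyperedge insertions/deletions. Parameters: $\beta=17$, $\alpha=1+36f^2\beta^2$, $L=\lceil f\log_\beta n\rceil+1$. Each node $v$ has a level $\ell(v)\in\{0,\ldots,L\}$, initially $0$. For a hyperedge $e$, $\ell(e)=\max_{v\in e}\ell(v)$ and $w(e)=\beta^{ -\ell(e)}$; $W_v=\sum_{e\ni v}w(e)$. For $v\in e$, $\ell_v(e)=\max_{u\in e,u\neq v}\ell(u)$, and $W_{v\to i}=\sum_{e\ni v}\beta^{ -\max(\ell_v(e),i)}$ (the value $W_v$ would take if $v$ moved to level $i$ with other levels unchanged). A node is Down-Dirty if $\ell(v)>0$ and $W_v\le 1/(\alpha\beta^2)$; it is Up-Dirty if either $\ell(v)=0$ and $W_v>1/\beta^2$, or $\ell(v)>0$ and $W_v\ge 1$. Algorithm: after each update, while some node is Down-Dirty or Up-Dirty: if some Up-Dirty node $v$ exists, with $i=\ell(v)$ move $v$ to the smallest level $j\in\{i+1,\ldots,L\}$ with $W_{v\to j}\le 1/\beta$ (an up-jump); otherwise pick a Down-Dirty node $v$, with $i=\ell(v)$ move $v$ to the largest level $j\in\{1,\ldots,i-1\}$ with $W_{v\to j}>1/\beta^2$, or to level $0$ if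 no such $j$ exists (a down-jump). Counters, all initially $0$: at each up-jump of $v$ from level $i$ to level $j$, $C^{up}$ increases by the number of hyperedges $e\ni v$ with $\ell_v(e)\le j-1$; at each down-jump of $v$ from level $i$, $C^{down}$ increases by the number of hyperedges $e\ni v$ with $\ell_v(e)\le i$, and $I^{down}$ increases by $\beta^{i-2}/\alpha$. -}

module Defs where

import Data.Nat as N
open import Data.Nat using (ℕ; zero; suc; _⊔_; _^_; _∸_)
open import Data.Nat.Properties using () renaming (_≤?_ to _≤ℕ?_)
open import Data.Bool using (Bool; true; false; if_then_else_; _∧_; not)
open import Data.Fin using (Fin)
import Data.Fin as Fin
open import Data.Fin.Subset using (Subset; ∣_∣)
open import Data.Vec using (lookup)
open import Data.List using (List; []; _∷_; _++_; foldr; map; allFin)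
open import Data.List.Membership.Propositional using (_∈_)
open import Data.Integer using (+_)
open import Data.Rational using (ℚ; _/_; 0ℚ; 1ℚ; _+_; _*_; _≤_; _<_)
open import Data.Product using (_×_; Σ)
open import Data.Sum using (_⊎_)
open import Relation.Nullary using (¬_; does)
open import Relation.Binary.PropositionalEquality using (_≡_)

β : ℕ
β = 17

α : ℕ → ℕ
α f = suc (36 N.* f N.* f N.* (β ^ 2))

-- ⌈ log_β m ⌉ : the least k with m ≤ β^k (taken to be 0 for m = 0).
-- Search with fuel m suffices since m ≤ β^m.
ceilLogβ : ℕ → ℕ
ceilLogβ m = go m 0
  where
  go : ℕ → ℕ → ℕ
  go zero    k = k
  go (suc t) k with m ≤ℕ? (β ^ k)
  ... | Relation.Nullary.yes _ = k
  ... | Relation.Nullary.no  _ = go t (suc k)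

-- L = ⌈ f log_β n ⌉ + 1 = ⌈ log_β (n^f) ⌉ + 1
Lmax : ℕ → ℕ → ℕ
Lmax n f = suc (ceilLogβ (n ^ f))

invPow : ℕ → ℚ
invPow zero    = 1ℚ
invPow (suc k) = invPow k * (+ 1 / 17)

powβ : ℕ → ℚ
powβ k = + (β ^ k) / 1

invα : ℕ → ℚ
invα f = + 1 / α f

-- f/(α-1) = f / (36 f² β²), for f ≥ 1 (junk value 0 at f = 0)
fOverαm1 : ℕ → ℚ
fOverαm1 zero    = 0ℚ
fOverαm1 (suc k) = + suc k / (36 N.* suc k N.* suc k N.* (β ^ 2))

ofℕ : ℕ → ℚ
ofℕ m = + m / 1

sumℚ : List ℚ → ℚ
sumℚ = foldr _+_ 0ℚ

Levels : ℕ → Set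
Levels n = Fin n → ℕ

Edge : ℕ → Set
Edge n = Subset n

maxOver : ∀ {n} → (Fin n → ℕ) → ℕ
maxOver {n} g = foldr _⊔_ 0 (map g (allFin n))

edgeLevel : ∀ {n} → Levels n → Edge n → ℕ
edgeLevel lev e = maxOver (λ u → if lookup e u then lev u else 0)

-- ℓ_v(e) = max_{u ∈ e, u ≠ v} ℓ(u)   (0 if e = {v})
otherLevel : ∀ {n} → Levels n → Fin n → Edge n → ℕ
otherLevel lev v e =
  maxOver (λ u → if lookup e u ∧ not (does (u Fin.≟ v)) then lev u else 0)

W : ∀ {n} → Levels n → List (Edge n) → Fin n → ℚ
W lev E v = sumℚ (map (λ e → if lookup e v then invPow (edgeLevel lev e) else 0ℚ) E)

Wto : ∀ {n} → Levels n → List (Edge n) → Fin n → ℕ → ℚ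
Wto lev E v i =
  sumℚ (map (λ e → if lookup e v then invPow (otherLevel lev v e ⊔ i) else 0ℚ) E)

countLE : ∀ {n} → Levels n → List (Edge n) → Fin n → ℕ → ℕ
countLE lev E v k =
  foldr N._+_ 0
    (map (λ e → if lookup e v ∧ does (otherLevel lev v e ≤ℕ? k) then 1 else 0) E)

setLevel : ∀ {n} → Levels n → Fin n → ℕ → Levels n
setLevel lev v j u = if does (u Fin.≟ v) then j else lev u

DownDirty : ∀ {n} → ℕ → Levels n → List (Edge n) → Fin n → Set
DownDirty f lev E v = 0 N.< lev v × W lev E v ≤ invα f * invPow 2

UpDirty : ∀ {n} → Levels n → List (Edge n) → Fin n → Set
UpDirty lev E v = (lev v ≡ 0 × invPow 2 < W lev E v) ⊎ (0 N.< lev v × 1ℚ ≤ W lev E v)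

UpTarget : ∀ {n} → ℕ → Levels n → List (Edge n) → Fin n → ℕ → Set
UpTarget L lev E v j =
  lev v N.< j × j N.≤ L × Wto lev E v j ≤ invPow 1 ×
  (∀ k → lev v N.< k → k N.< j → ¬ (Wto lev E v k ≤ invPow 1))

DownTarget : ∀ {n} → Levels n → List (Edge n) → Fin n → ℕ → Set
DownTarget lev E v j =
  (0 N.< j × j N.< lev v × invPow 2 < Wto lev E v j ×
    (∀ k → j N.< k → k N.< lev v → ¬ (invPow 2 < Wto lev E v k)))
  ⊎
  (j ≡ 0 × (∀ k → 0 N.< k → k N.< lev v → ¬ (invPow 2 < Wto lev E v k)))

record State (n : ℕ) : Set where
  constructor st
  field
    lev   : Levels n
    edges : List (Edge n)
    T     : ℕ
    Cup   : ℕ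
    Cdown : ℕ
    Idown : ℚ
open State public

initState : (n : ℕ) → State n
initState n = st (λ _ → 0) [] 0 0 0 0ℚ

-- no node is Up-Dirty or Down-Dirty (the while-loop has terminated)
Clean : ∀ {n} → ℕ → State n → Set
Clean f s = ∀ v → ¬ UpDirty (lev s) (edges s) v × ¬ DownDirty f (lev s) (edges s) v

data Step (n f : ℕ) : State n → State n → Set where
  insert : ∀ {l E t cu cd id} (e : Edge n) →
    Clean f (st l E t cu cd id) →
    1 N.≤ ∣ e ∣ → ∣ e ∣ N.≤ f → ¬ (e ∈ E) →
    Step n f (st l E t cu cd id) (st l (e ∷ E) (suc t) cu cd id)
  delete : ∀ {l t cu cd id} (xs ys : List (Edge n)) (e : Edge n) →
    Clean f (st l (xs ++ e ∷ ys) t cu cd id) →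
    Step n f (st l (xs ++ e ∷ ys) t cu cd id) (st l (xs ++ ys) (suc t) cu cd id)
  upJump : ∀ {l E t cu cd id} (v : Fin n) (j : ℕ) →
    UpDirty l E v → UpTarget (Lmax n f) l E v j →
    Step n f (st l E t cu cd id)
             (st (setLevel l v j) E t (cu N.+ countLE l E v (j ∸ 1)) cd id)
  downJump : ∀ {l E t cu cd id} (v : Fin n) (j : ℕ) →
    (∀ u → ¬ UpDirty l E u) → DownDirty f l E v → DownTarget l E v j →
    Step n f (st l E t cu cd id)
             (st (setLevel l v j) E t cu (cd N.+ countLE l E v (l v))
                 (id + (powβ (l v) * invPow 2) * invα f))

-- Let Φ = Σ_{v, ℓ(v) > 0} β^ℓ(v) · max(0, 1/β² − W_v).  We show that
--   (α − 1) · I^down + Φ ≤ f · (T + C^up)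
-- holds after every step; as Φ ≥ 0 this gives the bound.  An insertion only raises weights,
-- so Φ does not grow.  A deletion lowers W_u by at most β^−ℓ(u) for each of the ≤ f nodes u
-- of the hyperedge, raising Φ by at most f.  An up-jump of v to level j lowers W_u only through
-- hyperedges e ∋ u, v with ℓ_v(e) ≤ j − 1, each by at most β^−ℓ(u), while the term of v itself
-- is at most the number of such hyperedges.  A down-jump of v from level i only raises the other
-- weights, and the term of v, which is at least β^(i−2) (1 − 1/α) because v was Down-Dirty,
-- drops to 0; this pays for (α − 1) times the increment β^(i−2)/α of I^down.

module Submission where

open import Defs

module Potential where

  open import Algebra.Bundles using (CommutativeRing)
  open import Data.Bool using (Bool; true; false; if_then_else_; _∧_; not)
  open import Data.Fin using (Fin; zero; suc)
  import Data.Fin as Fin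
  import Data.Fin.Properties as FinP
  open import Data.Fin.Subset using (Subset; ∣_∣)
  import Data.Integer as ℤ
  import Data.Integer.Properties as ℤP
  import Data.Integer.Solver as ℤ-Solver
  open import Data.List using (List; []; _∷_; _++_; map; foldr; allFin)
  open import Data.List.Membership.Propositional using (_∈_)
  open import Data.List.Membership.Propositional.Properties using (∈-allFin)
  open import Data.List.Properties using (map-cong)
  open import Data.List.Relation.Unary.All as All using (All; []; _∷_)
  import Data.List.Relation.Unary.All.Properties as AllP
  open import Data.List.Relation.Unary.Any using (here; there)
  open import Data.Nat as ℕ using (ℕ; zero; suc; _⊔_; _∸_; z≤n; s≤s)
  import Data.Nat.Properties as ℕP
  open import Data.Product using (_×_; _,_; proj₁)
  open import Data.Rational as ℚ
    using (ℚ; 0ℚ; 1ℚ; _+_; _*_; _-_; -_; _≤_; _<_; _/_; toℚᵘ; nonNegative)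
  import Data.Rational.Properties as ℚP
  import Data.Rational.Solver as ℚ-Solver
  import Data.Rational.Unnormalised as ℚᵘ
  import Data.Rational.Unnormalised.Properties as ℚᵘP
  open import Data.Sum using (inj₁; inj₂)
  open import Data.Vec using ([]; _∷_; lookup)
  open import Function using (_∘_)
  open import Relation.Binary.Construct.Closure.ReflexiveTransitive using (Star; ε; _◅_)
  open import Relation.Binary.PropositionalEquality
  open import Relation.Nullary using (Dec; does; yes; no)
  open import Relation.Nullary.Decidable using (toWitness; dec-true; dec-false)
  open import Relation.Nullary.Reflects using (ofʸ; ofⁿ)

  open import Algebra.Properties.Semiring.Sum (CommutativeRing.semiring ℚP.+-*-commutativeRing)
    using (sum; sum-cong-≗; ∑-distrib-+; sum-replicate-zero; *-distribʳ-sum)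

  p≤p+q : ∀ p {q} → 0ℚ ≤ q → p ≤ p + q
  p≤p+q p {q} q≥0 = subst (_≤ p + q) (ℚP.+-identityʳ p) (ℚP.+-monoʳ-≤ p q≥0)

  p≤q+p : ∀ p {q} → 0ℚ ≤ q → p ≤ q + p
  p≤q+p p {q} q≥0 = subst (p ≤_) (ℚP.+-comm p q) (p≤p+q p q≥0)

  p-q≤p : ∀ p {q} → 0ℚ ≤ q → p - q ≤ p
  p-q≤p p {q} q≥0 = subst (p - q ≤_) (ℚP.+-identityʳ p) (ℚP.+-monoʳ-≤ p (ℚP.neg-antimono-≤ q≥0))

  *-nonneg : ∀ {p q} → 0ℚ ≤ p → 0ℚ ≤ q → 0ℚ ≤ p * q
  *-nonneg {p} {q} p≥0 q≥0 = ℚP.nonNegative⁻¹ (p * q)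
    {{ℚP.nonNeg*nonNeg⇒nonNeg p {{nonNegative p≥0}} q {{nonNegative q≥0}}}}

  *-monoˡ-≤ : ∀ {r p q} → 0ℚ ≤ r → p ≤ q → r * p ≤ r * q
  *-monoˡ-≤ {r} r≥0 = ℚP.*-monoˡ-≤-nonNeg r {{nonNegative r≥0}}

  *-monoʳ-≤ : ∀ {r p q} → 0ℚ ≤ r → p ≤ q → p * r ≤ q * r
  *-monoʳ-≤ {r} r≥0 = ℚP.*-monoʳ-≤-nonNeg r {{nonNegative r≥0}}

  ≤-transfer : ∀ a {p p' d b} → p' ≤ p + d → a + p ≤ b → a + p' ≤ b + d
  ≤-transfer a {p} {p'} {d} {b} p'≤p+d a+p≤b = begin
    a + p'        ≤⟨ ℚP.+-monoʳ-≤ a p'≤p+d ⟩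
    a + (p + d)   ≡⟨ ℚP.+-assoc a p d ⟨
    (a + p) + d   ≤⟨ ℚP.+-monoˡ-≤ d a+p≤b ⟩
    b + d         ∎
    where open ℚP.≤-Reasoning

  toℚᵘ-ofℕ : ∀ a → toℚᵘ (ofℕ a) ℚᵘ.≃ ℚᵘ.mkℚᵘ (ℤ.+ a) 0
  toℚᵘ-ofℕ a = ℚP.toℚᵘ-fromℚᵘ (ℚᵘ.mkℚᵘ (ℤ.+ a) 0)

  ofℕ-+ : ∀ a b → ofℕ (a ℕ.+ b) ≡ ofℕ a + ofℕ b
  ofℕ-+ a b = ℚP.toℚᵘ-injective (begin
    toℚᵘ (ofℕ (a ℕ.+ b))                          ≈⟨ toℚᵘ-ofℕ (a ℕ.+ b) ⟩
    ℚᵘ.mkℚᵘ (ℤ.+ a ℤ.+ ℤ.+ b) 0                    ≈⟨ ℚᵘ.*≡* (solve 2 (λ x y → (x :+ y) :* con (ℤ.+ 1)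
                                                       := (x :* con (ℤ.+ 1) :+ y :* con (ℤ.+ 1)) :* con (ℤ.+ 1))
                                                       refl (ℤ.+ a) (ℤ.+ b)) ⟩
    ℚᵘ.mkℚᵘ (ℤ.+ a) 0 ℚᵘ.+ ℚᵘ.mkℚᵘ (ℤ.+ b) 0      ≈⟨ ℚᵘP.+-cong (toℚᵘ-ofℕ a) (toℚᵘ-ofℕ b) ⟨
    toℚᵘ (ofℕ a) ℚᵘ.+ toℚᵘ (ofℕ b)                ≈⟨ ℚP.toℚᵘ-homo-+ (ofℕ a) (ofℕ b) ⟨
    toℚᵘ (ofℕ a + ofℕ b)                          ∎)
    where open ℚᵘP.≃-Reasoning
          open ℤ-Solver.+-*-Solver

  ofℕ-* : ∀ a b → ofℕ (a ℕ.* b) ≡ ofℕ a * ofℕ b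
  ofℕ-* a b = ℚP.toℚᵘ-injective (begin
    toℚᵘ (ofℕ (a ℕ.* b))                          ≈⟨ toℚᵘ-ofℕ (a ℕ.* b) ⟩
    ℚᵘ.mkℚᵘ (ℤ.+ (a ℕ.* b)) 0                     ≈⟨ ℚᵘ.*≡* (cong (ℤ._* ℤ.+ 1) (ℤP.pos-* a b)) ⟩
    ℚᵘ.mkℚᵘ (ℤ.+ a) 0 ℚᵘ.* ℚᵘ.mkℚᵘ (ℤ.+ b) 0      ≈⟨ ℚᵘP.*-cong (toℚᵘ-ofℕ a) (toℚᵘ-ofℕ b) ⟨
    toℚᵘ (ofℕ a) ℚᵘ.* toℚᵘ (ofℕ b)                ≈⟨ ℚP.toℚᵘ-homo-* (ofℕ a) (ofℕ b) ⟨
    toℚᵘ (ofℕ a * ofℕ b)                          ∎)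
    where open ℚᵘP.≃-Reasoning

  ofℕ-*-/-cancel : ∀ a d → ofℕ (suc d) * (ℤ.+ a / suc d) ≡ ofℕ a
  ofℕ-*-/-cancel a d = ℚP.toℚᵘ-injective (begin
    toℚᵘ (ofℕ (suc d) * (ℤ.+ a / suc d))          ≈⟨ ℚP.toℚᵘ-homo-* (ofℕ (suc d)) (ℤ.+ a / suc d) ⟩
    toℚᵘ (ofℕ (suc d)) ℚᵘ.* toℚᵘ (ℤ.+ a / suc d)  ≈⟨ ℚᵘP.*-cong (toℚᵘ-ofℕ (suc d))
                                                       (ℚP.toℚᵘ-fromℚᵘ (ℚᵘ.mkℚᵘ (ℤ.+ a) d)) ⟩
    ℚᵘ.mkℚᵘ (ℤ.+ suc d) 0 ℚᵘ.* ℚᵘ.mkℚᵘ (ℤ.+ a) d  ≈⟨ ℚᵘ.*≡* (solve 2 (λ x y → (x :* y) :* con (ℤ.+ 1)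
                                                       := y :* (con (ℤ.+ 1) :* x)) refl (ℤ.+ suc d) (ℤ.+ a)) ⟩
    ℚᵘ.mkℚᵘ (ℤ.+ a) 0                             ≈⟨ toℚᵘ-ofℕ a ⟨
    toℚᵘ (ofℕ a)                                  ∎)
    where open ℚᵘP.≃-Reasoning
          open ℤ-Solver.+-*-Solver

  ofℕ-nonneg : ∀ a → 0ℚ ≤ ofℕ a
  ofℕ-nonneg a = ℚP.nonNegative⁻¹ (ofℕ a) {{ℚP.normalize-nonNeg a 1}}

  ofℕ-mono-≤ : ∀ {a b} → a ℕ.≤ b → ofℕ a ≤ ofℕ b
  ofℕ-mono-≤ {a} a≤b with ℕP.m≤n⇒∃[o]m+o≡n a≤b
  ... | c , refl = subst (ofℕ a ≤_) (sym (ofℕ-+ a c)) (p≤p+q (ofℕ a) (ofℕ-nonneg c))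

  invPow-nonneg : ∀ k → 0ℚ ≤ invPow k
  invPow-nonneg zero    = toWitness {a? = 0ℚ ℚP.≤? 1ℚ} _
  invPow-nonneg (suc k) = *-nonneg (invPow-nonneg k) (toWitness {a? = 0ℚ ℚP.≤? (ℤ.+ 1 / 17)} _)

  invPow-suc-≤ : ∀ k → invPow (suc k) ≤ invPow k
  invPow-suc-≤ k = subst (invPow (suc k) ≤_) (ℚP.*-identityʳ (invPow k))
    (*-monoˡ-≤ (invPow-nonneg k) (toWitness {a? = (ℤ.+ 1 / 17) ℚP.≤? 1ℚ} _))

  invPow-antitone : ∀ {a b} → a ℕ.≤ b → invPow b ≤ invPow a
  invPow-antitone {b = zero}  z≤n = ℚP.≤-refl
  invPow-antitone {b = suc b} a≤1+b with ℕP.m≤n⇒m<n∨m≡n a≤1+b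
  ... | inj₁ (s≤s a≤b) = ℚP.≤-trans (invPow-suc-≤ b) (invPow-antitone a≤b)
  ... | inj₂ refl      = ℚP.≤-refl

  β*invPow-suc : ∀ k → ofℕ β * invPow (suc k) ≡ invPow k
  β*invPow-suc k = begin
    ofℕ β * (invPow k * (ℤ.+ 1 / 17))   ≡⟨ solve 3 (λ b i c → b :* (i :* c) := i :* (b :* c))
                                             refl (ofℕ β) (invPow k) (ℤ.+ 1 / 17) ⟩
    invPow k * (ofℕ β * (ℤ.+ 1 / 17))   ≡⟨ ℚP.*-identityʳ (invPow k) ⟩
    invPow k                            ∎
    where open ≡-Reasoning
          open ℚ-Solver.+-*-Solver

  powβ-nonneg : ∀ k → 0ℚ ≤ powβ k
  powβ-nonneg k = ofℕ-nonneg (β ℕ.^ k)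

  powβ*invPow : ∀ k → powβ k * invPow k ≡ 1ℚ
  powβ*invPow zero    = refl
  powβ*invPow (suc k) = begin
    powβ (suc k) * invPow (suc k)       ≡⟨ cong (_* invPow (suc k)) (ofℕ-* β (β ℕ.^ k)) ⟩
    (ofℕ β * powβ k) * invPow (suc k)   ≡⟨ solve 3 (λ b p i → (b :* p) :* i := p :* (b :* i))
                                             refl (ofℕ β) (powβ k) (invPow (suc k)) ⟩
    powβ k * (ofℕ β * invPow (suc k))   ≡⟨ cong (powβ k *_) (β*invPow-suc k) ⟩
    powβ k * invPow k                   ≡⟨ powβ*invPow k ⟩
    1ℚ                                  ∎
    where open ≡-Reasoning
          open ℚ-Solver.+-*-Solver

  α∸1 : ℕ → ℕ
  α∸1 f = α f ∸ 1

  α∸1*invα : ∀ f → ofℕ (α∸1 f) * invα f ≡ 1ℚ - invα f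
  α∸1*invα f = begin
    D * a               ≡⟨ solve 2 (λ D a → D :* a := (con 1ℚ :+ D) :* a :- a) refl D a ⟩
    (1ℚ + D) * a - a    ≡⟨ cong (λ x → x * a - a) (ofℕ-+ 1 (α∸1 f)) ⟨
    ofℕ (α f) * a - a   ≡⟨ cong (_- a) (ofℕ-*-/-cancel 1 (α∸1 f)) ⟩
    1ℚ - a              ∎
    where open ≡-Reasoning
          open ℚ-Solver.+-*-Solver
          D = ofℕ (α∸1 f)
          a = invα f

  α∸1*p+q≤r*f⇒p≤fOverαm1*r : ∀ k {p q} r → 0ℚ ≤ q →
    ofℕ (α∸1 (suc k)) * p + q ≤ ofℕ r * ofℕ (suc k) → p ≤ fOverαm1 (suc k) * ofℕ r
  α∸1*p+q≤r*f⇒p≤fOverαm1*r k {p} {q} r q≥0 bound =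
    ℚP.*-cancelˡ-≤-pos D {{ℚP.normalize-pos (α∸1 (suc k)) 1}} (begin
      D * p                            ≤⟨ p≤p+q (D * p) q≥0 ⟩
      D * p + q                        ≤⟨ bound ⟩
      ofℕ r * ofℕ (suc k)              ≡⟨ ℚP.*-comm (ofℕ r) (ofℕ (suc k)) ⟩
      ofℕ (suc k) * ofℕ r              ≡⟨ cong (_* ofℕ r) (ofℕ-*-/-cancel (suc k) (ℕ.pred (α∸1 (suc k)))) ⟨
      (D * fOverαm1 (suc k)) * ofℕ r   ≡⟨ ℚP.*-assoc D (fOverαm1 (suc k)) (ofℕ r) ⟩
      D * (fOverαm1 (suc k) * ofℕ r)   ∎)
    where open ℚP.≤-Reasoning
          D = ofℕ (α∸1 (suc k))

  [_]⁺ : ℚ → ℚ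
  [ x ]⁺ = 0ℚ ℚ.⊔ x

  [x]⁺-nonneg : ∀ x → 0ℚ ≤ [ x ]⁺
  [x]⁺-nonneg = ℚP.p≤p⊔q 0ℚ

  x≤[x]⁺ : ∀ x → x ≤ [ x ]⁺
  x≤[x]⁺ = ℚP.p≤q⊔p 0ℚ

  [-]⁺-mono-≤ : ∀ {x y} → x ≤ y → [ x ]⁺ ≤ [ y ]⁺
  [-]⁺-mono-≤ = ℚP.⊔-monoʳ-≤ 0ℚ

  [x+d]⁺≤[x]⁺+d : ∀ x {d} → 0ℚ ≤ d → [ x + d ]⁺ ≤ [ x ]⁺ + d
  [x+d]⁺≤[x]⁺+d x {d} d≥0 =
    ℚP.⊔-lub (ℚP.≤-trans ([x]⁺-nonneg x) (p≤p+q [ x ]⁺ d≥0)) (ℚP.+-monoˡ-≤ d (x≤[x]⁺ x))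

  [x]⁺≡0 : ∀ {x} → x ≤ 0ℚ → [ x ]⁺ ≡ 0ℚ
  [x]⁺≡0 = ℚP.p≥q⇒p⊔q≡p

  𝟙 : Bool → ℚ
  𝟙 true  = 1ℚ
  𝟙 false = 0ℚ

  𝟙-nonneg : ∀ b → 0ℚ ≤ 𝟙 b
  𝟙-nonneg true  = toWitness {a? = 0ℚ ℚP.≤? 1ℚ} _
  𝟙-nonneg false = ℚP.≤-refl

  𝟙-∧ : ∀ a b → 𝟙 (a ∧ b) ≡ 𝟙 a * 𝟙 b
  𝟙-∧ true  b = sym (ℚP.*-identityˡ (𝟙 b))
  𝟙-∧ false b = sym (ℚP.*-zeroˡ (𝟙 b))

  ∧-repeat : ∀ a b → a ∧ b ≡ a ∧ (a ∧ b)
  ∧-repeat true  _ = refl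
  ∧-repeat false _ = refl

  module _ {A : Set} where

    sumℚ-map-mono-≤ : ∀ {g h : A → ℚ} {xs} → All (λ x → g x ≤ h x) xs →
      sumℚ (map g xs) ≤ sumℚ (map h xs)
    sumℚ-map-mono-≤ []           = ℚP.≤-refl
    sumℚ-map-mono-≤ (gx≤hx ∷ ps) = ℚP.+-mono-≤ gx≤hx (sumℚ-map-mono-≤ ps)

    sumℚ-map-nonneg : ∀ {g : A → ℚ} xs → (∀ x → 0ℚ ≤ g x) → 0ℚ ≤ sumℚ (map g xs)
    sumℚ-map-nonneg []       _   = ℚP.≤-refl
    sumℚ-map-nonneg (x ∷ xs) g≥0 = ℚP.+-mono-≤ (g≥0 x) (sumℚ-map-nonneg xs g≥0)

    sumℚ-map-+ : ∀ (g h : A → ℚ) xs →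
      sumℚ (map (λ x → g x + h x) xs) ≡ sumℚ (map g xs) + sumℚ (map h xs)
    sumℚ-map-+ g h []       = refl
    sumℚ-map-+ g h (x ∷ xs) = begin
      (g x + h x) + sumℚ (map (λ x → g x + h x) xs)   ≡⟨ cong ((g x + h x) +_) (sumℚ-map-+ g h xs) ⟩
      (g x + h x) + (G + H)                           ≡⟨ solve 4 (λ a b c d → (a :+ b) :+ (c :+ d) := (a :+ c) :+ (b :+ d))
                                                           refl (g x) (h x) G H ⟩
      (g x + G) + (h x + H)                           ∎
      where open ≡-Reasoning
            open ℚ-Solver.+-*-Solver
            G = sumℚ (map g xs)
            H = sumℚ (map h xs)

    sumℚ-map-≤-+ : ∀ {g h k : A → ℚ} xs → (∀ x → g x ≤ h x + k x) →
      sumℚ (map g xs) ≤ sumℚ (map h xs) + sumℚ (map k xs)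
    sumℚ-map-≤-+ {g} {h} {k} xs g≤h+k =
      subst (sumℚ (map g xs) ≤_) (sumℚ-map-+ h k xs) (sumℚ-map-mono-≤ (All.universal g≤h+k xs))

    sumℚ-map-*ʳ : ∀ c (g : A → ℚ) xs → sumℚ (map (λ x → g x * c) xs) ≡ sumℚ (map g xs) * c
    sumℚ-map-*ʳ c g []       = sym (ℚP.*-zeroˡ c)
    sumℚ-map-*ʳ c g (x ∷ xs) =
      trans (cong (g x * c +_) (sumℚ-map-*ʳ c g xs)) (sym (ℚP.*-distribʳ-+ c (g x) (sumℚ (map g xs))))

    sumℚ-map-++-∷ : ∀ (g : A → ℚ) xs x ys →
      sumℚ (map g (xs ++ x ∷ ys)) ≡ g x + sumℚ (map g (xs ++ ys))
    sumℚ-map-++-∷ g []       x ys = refl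
    sumℚ-map-++-∷ g (y ∷ xs) x ys = begin
      g y + sumℚ (map g (xs ++ x ∷ ys))   ≡⟨ cong (g y +_) (sumℚ-map-++-∷ g xs x ys) ⟩
      g y + (g x + S)                     ≡⟨ ℚP.+-assoc (g y) (g x) S ⟨
      (g y + g x) + S                     ≡⟨ cong (_+ S) (ℚP.+-comm (g y) (g x)) ⟩
      (g x + g y) + S                     ≡⟨ ℚP.+-assoc (g x) (g y) S ⟩
      g x + (g y + S)                     ∎
      where open ≡-Reasoning
            S = sumℚ (map g (xs ++ ys))

    ofℕ-count : ∀ (p : A → Bool) xs →
      ofℕ (foldr ℕ._+_ 0 (map (λ x → if p x then 1 else 0) xs)) ≡ sumℚ (map (𝟙 ∘ p) xs)
    ofℕ-count p []       = refl
    ofℕ-count p (x ∷ xs) =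
      trans (ofℕ-+ (if p x then 1 else 0) _) (cong₂ _+_ (ofℕ-if (p x)) (ofℕ-count p xs))
      where
      ofℕ-if : ∀ b → ofℕ (if b then 1 else 0) ≡ 𝟙 b
      ofℕ-if true  = refl
      ofℕ-if false = refl

  sum-mono-≤ : ∀ {n} {g h : Fin n → ℚ} → (∀ u → g u ≤ h u) → sum g ≤ sum h
  sum-mono-≤ {zero}  _   = ℚP.≤-refl
  sum-mono-≤ {suc n} g≤h = ℚP.+-mono-≤ (g≤h zero) (sum-mono-≤ (g≤h ∘ suc))

  sum-nonneg : ∀ {n} {g : Fin n → ℚ} → (∀ u → 0ℚ ≤ g u) → 0ℚ ≤ sum g
  sum-nonneg {zero}  _   = ℚP.≤-refl
  sum-nonneg {suc n} g≥0 = ℚP.+-mono-≤ (g≥0 zero) (sum-nonneg (g≥0 ∘ suc))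

  sum-≤-+ : ∀ {n} {g h k : Fin n → ℚ} → (∀ u → g u ≤ h u + k u) → sum g ≤ sum h + sum k
  sum-≤-+ {g = g} {h} {k} g≤h+k = subst (sum g ≤_) (∑-distrib-+ h k) (sum-mono-≤ g≤h+k)

  sum-+-≤-except : ∀ {n} {g h : Fin n → ℚ} (v : Fin n) {x} →
    (∀ u → u ≢ v → g u ≤ h u) → g v + x ≤ h v → sum g + x ≤ sum h
  sum-+-≤-except {suc n} {g} {h} zero {x} g≤h gv+x≤hv = begin
    (g zero + sum (g ∘ suc)) + x   ≡⟨ solve 3 (λ a s x → (a :+ s) :+ x := (a :+ x) :+ s)
                                        refl (g zero) (sum (g ∘ suc)) x ⟩
    (g zero + x) + sum (g ∘ suc)   ≤⟨ ℚP.+-mono-≤ gv+x≤hv (sum-mono-≤ (λ u → g≤h (suc u) λ ())) ⟩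
    h zero + sum (h ∘ suc)         ∎
    where open ℚP.≤-Reasoning
          open ℚ-Solver.+-*-Solver
  sum-+-≤-except {suc n} {g} {h} (suc v) {x} g≤h gv+x≤hv = begin
    (g zero + sum (g ∘ suc)) + x   ≡⟨ ℚP.+-assoc (g zero) (sum (g ∘ suc)) x ⟩
    g zero + (sum (g ∘ suc) + x)   ≤⟨ ℚP.+-mono-≤ (g≤h zero λ ())
                                        (sum-+-≤-except v (λ u u≢v → g≤h (suc u) (u≢v ∘ FinP.suc-injective)) gv+x≤hv) ⟩
    h zero + sum (h ∘ suc)         ∎
    where open ℚP.≤-Reasoning

  sum-𝟙 : ∀ {n} (e : Subset n) → sum (λ u → 𝟙 (lookup e u)) ≡ ofℕ ∣ e ∣
  sum-𝟙 []          = refl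
  sum-𝟙 (true ∷ e)  = trans (cong (1ℚ +_) (sum-𝟙 e)) (sym (ofℕ-+ 1 ∣ e ∣))
  sum-𝟙 (false ∷ e) = trans (ℚP.+-identityˡ _) (sum-𝟙 e)

  sum-𝟙-∧ : ∀ {n} (e : Subset n) b → sum (λ u → 𝟙 (lookup e u ∧ b)) ≡ ofℕ ∣ e ∣ * 𝟙 b
  sum-𝟙-∧ e b = begin
    sum (λ u → 𝟙 (lookup e u ∧ b))     ≡⟨ sum-cong-≗ (λ u → 𝟙-∧ (lookup e u) b) ⟩
    sum (λ u → 𝟙 (lookup e u) * 𝟙 b)   ≡⟨ *-distribʳ-sum (𝟙 b) (λ u → 𝟙 (lookup e u)) ⟨
    sum (λ u → 𝟙 (lookup e u)) * 𝟙 b   ≡⟨ cong (_* 𝟙 b) (sum-𝟙 e) ⟩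
    ofℕ ∣ e ∣ * 𝟙 b                    ∎
    where open ≡-Reasoning

  sum-sumℚ-comm : ∀ {n} {A : Set} (g : Fin n → A → ℚ) xs →
    sum (λ u → sumℚ (map (g u) xs)) ≡ sumℚ (map (λ x → sum (λ u → g u x)) xs)
  sum-sumℚ-comm {n} g []       = sum-replicate-zero n
  sum-sumℚ-comm     g (x ∷ xs) = trans (∑-distrib-+ (λ u → g u x) (λ u → sumℚ (map (g u) xs)))
    (cong (sum (λ u → g u x) +_) (sum-sumℚ-comm g xs))

  module _ {n : ℕ} where

    maxOver-upper : ∀ (g : Fin n → ℕ) u → g u ℕ.≤ maxOver g
    maxOver-upper g u = go (allFin n) (∈-allFin u)
      where
      go : ∀ xs → u ∈ xs → g u ℕ.≤ foldr _⊔_ 0 (map g xs)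
      go (x ∷ xs) (here refl)  = ℕP.m≤m⊔n (g x) _
      go (x ∷ xs) (there u∈xs) = ℕP.m≤n⇒m≤o⊔n (g x) (go xs u∈xs)

    maxOver-least : ∀ (g : Fin n → ℕ) {m} → (∀ u → g u ℕ.≤ m) → maxOver g ℕ.≤ m
    maxOver-least g {m} g≤m = go (allFin n)
      where
      go : ∀ xs → foldr _⊔_ 0 (map g xs) ℕ.≤ m
      go []       = z≤n
      go (x ∷ xs) = ℕP.⊔-lub (g≤m x) (go xs)

    maxOver-mono-≤ : ∀ {g h : Fin n → ℕ} → (∀ u → g u ℕ.≤ h u) → maxOver g ℕ.≤ maxOver h
    maxOver-mono-≤ {g} {h} g≤h = maxOver-least g (λ u → ℕP.≤-trans (g≤h u) (maxOver-upper h u))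

    maxOver-cong : ∀ {g h : Fin n → ℕ} → (∀ u → g u ≡ h u) → maxOver g ≡ maxOver h
    maxOver-cong g≡h = ℕP.≤-antisym (maxOver-mono-≤ (ℕP.≤-reflexive ∘ g≡h))
                                    (maxOver-mono-≤ (ℕP.≤-reflexive ∘ sym ∘ g≡h))

    setLevel-self : ∀ (lev : Levels n) v j → setLevel lev v j v ≡ j
    setLevel-self lev v j = cong (λ b → if b then j else lev v) (dec-true (v Fin.≟ v) refl)

    setLevel-other : ∀ (lev : Levels n) v j {u} → u ≢ v → setLevel lev v j u ≡ lev u
    setLevel-other lev v j {u} u≢v = cong (λ b → if b then j else lev u) (dec-false (u Fin.≟ v) u≢v)

    setLevel-≤ : ∀ (lev : Levels n) v {j} → j ℕ.≤ lev v → ∀ u → setLevel lev v j u ℕ.≤ lev u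
    setLevel-≤ lev v j≤lv u with u Fin.≟ v
    ... | yes refl = j≤lv
    ... | no  _    = ℕP.≤-refl

    member-≤-edgeLevel : ∀ (lev : Levels n) e {u} → lookup e u ≡ true → lev u ℕ.≤ edgeLevel lev e
    member-≤-edgeLevel lev e {u} u∈e =
      subst (ℕ._≤ edgeLevel lev e) (cong (λ b → if b then lev u else 0) u∈e)
        (maxOver-upper (λ u → if lookup e u then lev u else 0) u)

    edgeLevel≡otherLevel⊔ : ∀ (lev : Levels n) v e → lookup e v ≡ true →
      edgeLevel lev e ≡ otherLevel lev v e ⊔ lev v
    edgeLevel≡otherLevel⊔ lev v e v∈e = ℕP.≤-antisym (maxOver-least _ split)
      (ℕP.⊔-lub (maxOver-mono-≤ other≤) (member-≤-edgeLevel lev e v∈e))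
      where
      other≤ : ∀ u → (if lookup e u ∧ not (does (u Fin.≟ v)) then lev u else 0)
                   ℕ.≤ (if lookup e u then lev u else 0)
      other≤ u with lookup e u | u Fin.≟ v
      ... | true  | yes _ = z≤n
      ... | true  | no  _ = ℕP.≤-refl
      ... | false | _     = z≤n
      split : ∀ u → (if lookup e u then lev u else 0) ℕ.≤ otherLevel lev v e ⊔ lev v
      split u with lookup e u in u∈e | u Fin.≟ v
      ... | false | _        = z≤n
      ... | true  | yes refl = ℕP.m≤n⊔m _ (lev u)
      ... | true  | no  u≢v  = ℕP.m≤n⇒m≤n⊔o (lev v) (subst (ℕ._≤ otherLevel lev v e)
        (cong₂ (λ a b → if a ∧ not b then lev u else 0) u∈e (dec-false (u Fin.≟ v) u≢v))
        (maxOver-upper (λ u → if lookup e u ∧ not (does (u Fin.≟ v)) then lev u else 0) u))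

    otherLevel-setLevel : ∀ (lev : Levels n) v j e → otherLevel (setLevel lev v j) v e ≡ otherLevel lev v e
    otherLevel-setLevel lev v j e = maxOver-cong agree
      where
      agree : ∀ u → (if lookup e u ∧ not (does (u Fin.≟ v)) then setLevel lev v j u else 0)
                  ≡ (if lookup e u ∧ not (does (u Fin.≟ v)) then lev u else 0)
      agree u with lookup e u | u Fin.≟ v
      ... | true  | yes _ = refl
      ... | true  | no  _ = refl
      ... | false | _     = refl

    edgeLevel-setLevel-∉ : ∀ (lev : Levels n) v j e → lookup e v ≡ false →
      edgeLevel (setLevel lev v j) e ≡ edgeLevel lev e
    edgeLevel-setLevel-∉ lev v j e v∉e = maxOver-cong agree
      where
      agree : ∀ u → (if lookup e u then setLevel lev v j u else 0) ≡ (if lookup e u then lev u else 0)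
      agree u with u Fin.≟ v
      ... | yes refl rewrite v∉e = refl
      ... | no  _                = refl

    edgeLevel-setLevel-∈ : ∀ (lev : Levels n) v j e → lookup e v ≡ true →
      edgeLevel (setLevel lev v j) e ≡ otherLevel lev v e ⊔ j
    edgeLevel-setLevel-∈ lev v j e v∈e = trans (edgeLevel≡otherLevel⊔ (setLevel lev v j) v e v∈e)
      (cong₂ _⊔_ (otherLevel-setLevel lev v j e) (setLevel-self lev v j))

    edgeLevel-mono-≤ : ∀ {lev lev' : Levels n} e → (∀ u → lev u ℕ.≤ lev' u) →
      edgeLevel lev e ℕ.≤ edgeLevel lev' e
    edgeLevel-mono-≤ {lev} {lev'} e lev≤lev' = maxOver-mono-≤ pointwise
      where
      pointwise : ∀ u → (if lookup e u then lev u else 0) ℕ.≤ (if lookup e u then lev' u else 0)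
      pointwise u with lookup e u
      ... | true  = lev≤lev' u
      ... | false = z≤n

    edgeWeight : Levels n → Fin n → Edge n → ℚ
    edgeWeight lev u e = if lookup e u then invPow (edgeLevel lev e) else 0ℚ

    edgeWeightTo : Levels n → Fin n → ℕ → Edge n → ℚ
    edgeWeightTo lev v i e = if lookup e v then invPow (otherLevel lev v e ⊔ i) else 0ℚ

    isLow : Levels n → Fin n → ℕ → Edge n → Bool
    isLow lev v k e = lookup e v ∧ (otherLevel lev v e ℕ.≤ᵇ k)

    ofℕ-countLE : ∀ (lev : Levels n) E v k → ofℕ (countLE lev E v k) ≡ sumℚ (map (𝟙 ∘ isLow lev v k) E)
    ofℕ-countLE lev E v k = ofℕ-count (isLow lev v k) E

    edgeWeight-nonneg : ∀ (lev : Levels n) u e → 0ℚ ≤ edgeWeight lev u e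
    edgeWeight-nonneg lev u e with lookup e u
    ... | true  = invPow-nonneg (edgeLevel lev e)
    ... | false = ℚP.≤-refl

    edgeWeight-≤-𝟙*invPow : ∀ (lev : Levels n) u e → edgeWeight lev u e ≤ 𝟙 (lookup e u) * invPow (lev u)
    edgeWeight-≤-𝟙*invPow lev u e with lookup e u in u∈e
    ... | true  = subst (invPow (edgeLevel lev e) ≤_) (sym (ℚP.*-identityˡ (invPow (lev u))))
                    (invPow-antitone (member-≤-edgeLevel lev e u∈e))
    ... | false = ℚP.≤-reflexive (sym (ℚP.*-zeroˡ (invPow (lev u))))

    edgeWeight-antitone : ∀ {lev lev' : Levels n} u e → (∀ w → lev' w ℕ.≤ lev w) →
      edgeWeight lev u e ≤ edgeWeight lev' u e
    edgeWeight-antitone u e lev'≤lev with lookup e u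
    ... | true  = invPow-antitone (edgeLevel-mono-≤ e lev'≤lev)
    ... | false = ℚP.≤-refl

    -- Raising v to level j changes the level of e only if ℓ_v(e) < j, that is, if e is low.
    edgeWeight-upJump : ∀ (lev : Levels n) v {j} u e → lev v ℕ.< j →
      edgeWeight lev u e ≤ edgeWeight (setLevel lev v j) u e + 𝟙 (lookup e u ∧ isLow lev v (j ∸ 1) e) * invPow (lev u)
    edgeWeight-upJump lev v {suc i} u e (s≤s lv≤i) = bound
      where
      lev' = setLevel lev v (suc i)
      m = otherLevel lev v e
      bound : edgeWeight lev u e ≤ edgeWeight lev' u e + 𝟙 (lookup e u ∧ (lookup e v ∧ (m ℕ.≤ᵇ i))) * invPow (lev u)
      bound with lookup e u in u∈e | lookup e v in v∈e | m ℕ.≤ᵇ i | ℕP.≤ᵇ-reflects-≤ m i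
      ... | false | _     | _     | _       = p≤p+q 0ℚ (*-nonneg ℚP.≤-refl (invPow-nonneg (lev u)))
      ... | true  | false | _     | _       = begin
        invPow (edgeLevel lev e)                          ≡⟨ cong invPow (edgeLevel-setLevel-∉ lev v (suc i) e v∈e) ⟨
        invPow (edgeLevel lev' e)                         ≤⟨ p≤p+q _ (*-nonneg ℚP.≤-refl (invPow-nonneg (lev u))) ⟩
        invPow (edgeLevel lev' e) + 0ℚ * invPow (lev u)   ∎
        where open ℚP.≤-Reasoning
      ... | true  | true  | true  | ofʸ m≤i = begin
        invPow (edgeLevel lev e)                          ≤⟨ invPow-antitone (member-≤-edgeLevel lev e u∈e) ⟩
        invPow (lev u)                                    ≡⟨ ℚP.*-identityˡ (invPow (lev u)) ⟨
        1ℚ * invPow (lev u)                               ≤⟨ p≤q+p _ (invPow-nonneg (edgeLevel lev' e)) ⟩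
        invPow (edgeLevel lev' e) + 1ℚ * invPow (lev u)   ∎
        where open ℚP.≤-Reasoning
      ... | true  | true  | false | ofⁿ m≰i = begin
        invPow (edgeLevel lev e)                          ≡⟨ cong invPow (trans (edgeLevel≡otherLevel⊔ lev v e v∈e)
                                                               (ℕP.m≥n⇒m⊔n≡m (ℕP.≤-trans lv≤i (ℕP.<⇒≤ i<m)))) ⟩
        invPow m                                          ≡⟨ cong invPow (trans (edgeLevel-setLevel-∈ lev v (suc i) e v∈e)
                                                               (ℕP.m≥n⇒m⊔n≡m i<m)) ⟨
        invPow (edgeLevel lev' e)                         ≤⟨ p≤p+q _ (*-nonneg ℚP.≤-refl (invPow-nonneg (lev u))) ⟩
        invPow (edgeLevel lev' e) + 0ℚ * invPow (lev u)   ∎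
        where open ℚP.≤-Reasoning
              i<m = ℕP.≰⇒> m≰i

    W≡Wto-level : ∀ (lev : Levels n) E v → W lev E v ≡ Wto lev E v (lev v)
    W≡Wto-level lev E v = cong sumℚ (map-cong agree E)
      where
      agree : ∀ e → edgeWeight lev v e ≡ edgeWeightTo lev v (lev v) e
      agree e with lookup e v in v∈e
      ... | true  = cong invPow (edgeLevel≡otherLevel⊔ lev v e v∈e)
      ... | false = refl

    W-setLevel-self : ∀ (lev : Levels n) E v j → W (setLevel lev v j) E v ≡ Wto lev E v j
    W-setLevel-self lev E v j = cong sumℚ (map-cong agree E)
      where
      agree : ∀ e → edgeWeight (setLevel lev v j) v e ≡ edgeWeightTo lev v j e
      agree e with lookup e v in v∈e
      ... | true  = cong invPow (edgeLevel-setLevel-∈ lev v j e v∈e)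
      ... | false = refl

    W-antitone : ∀ {lev lev' : Levels n} E u → (∀ w → lev' w ℕ.≤ lev w) → W lev E u ≤ W lev' E u
    W-antitone E u lev'≤lev = sumℚ-map-mono-≤ (All.universal (λ e → edgeWeight-antitone u e lev'≤lev) E)

    W-upJump : ∀ (lev : Levels n) E v {j} u → lev v ℕ.< j →
      W lev E u ≤ W (setLevel lev v j) E u
                  + sumℚ (map (λ e → 𝟙 (lookup e u ∧ isLow lev v (j ∸ 1) e)) E) * invPow (lev u)
    W-upJump lev E v {j} u lv<j =
      subst (W lev E u ≤_) (cong (W (setLevel lev v j) E u +_) (sumℚ-map-*ʳ (invPow (lev u)) _ E))
        (sumℚ-map-≤-+ E (λ e → edgeWeight-upJump lev v u e lv<j))

    Wto-nonneg : ∀ (lev : Levels n) E v k → 0ℚ ≤ Wto lev E v k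
    Wto-nonneg lev E v k = sumℚ-map-nonneg E nonneg
      where
      nonneg : ∀ e → 0ℚ ≤ edgeWeightTo lev v k e
      nonneg e with lookup e v
      ... | true  = invPow-nonneg (otherLevel lev v e ⊔ k)
      ... | false = ℚP.≤-refl

    Wto-≤-β*Wto-suc : ∀ (lev : Levels n) E v k → Wto lev E v k ≤ ofℕ β * Wto lev E v (suc k)
    Wto-≤-β*Wto-suc lev E v k = subst (Wto lev E v k ≤_)
      (trans (sumℚ-map-*ʳ (ofℕ β) (edgeWeightTo lev v (suc k)) E) (ℚP.*-comm (Wto lev E v (suc k)) (ofℕ β)))
      (sumℚ-map-mono-≤ (All.universal step E))
      where
      step : ∀ e → edgeWeightTo lev v k e ≤ edgeWeightTo lev v (suc k) e * ofℕ β
      step e with lookup e v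
      ... | false = ℚP.≤-reflexive (sym (ℚP.*-zeroˡ (ofℕ β)))
      ... | true  = begin
        invPow (m ⊔ k)                 ≡⟨ β*invPow-suc (m ⊔ k) ⟨
        ofℕ β * invPow (suc (m ⊔ k))   ≤⟨ *-monoˡ-≤ (ofℕ-nonneg β) (invPow-antitone
                                            (ℕP.⊔-lub (ℕP.m≤n⇒m≤1+n (ℕP.m≤m⊔n m k)) (s≤s (ℕP.m≤n⊔m m k)))) ⟩
        ofℕ β * invPow (m ⊔ suc k)     ≡⟨ ℚP.*-comm (ofℕ β) (invPow (m ⊔ suc k)) ⟩
        invPow (m ⊔ suc k) * ofℕ β     ∎
        where open ℚP.≤-Reasoning
              m = otherLevel lev v e

    Wto-≤-Wto-suc+countLE : ∀ (lev : Levels n) E v k →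
      Wto lev E v k ≤ Wto lev E v (suc k) + ofℕ (countLE lev E v k) * invPow k
    Wto-≤-Wto-suc+countLE lev E v k = subst (Wto lev E v k ≤_)
      (cong (Wto lev E v (suc k) +_) (trans (sumℚ-map-*ʳ (invPow k) (𝟙 ∘ isLow lev v k) E)
                                            (cong (_* invPow k) (sym (ofℕ-countLE lev E v k)))))
      (sumℚ-map-≤-+ E step)
      where
      step : ∀ e → edgeWeightTo lev v k e ≤
        edgeWeightTo lev v (suc k) e + 𝟙 (lookup e v ∧ (otherLevel lev v e ℕ.≤ᵇ k)) * invPow k
      step e with lookup e v | otherLevel lev v e ℕ.≤ᵇ k | ℕP.≤ᵇ-reflects-≤ (otherLevel lev v e) k
      ... | false | _     | _       = p≤p+q 0ℚ (*-nonneg ℚP.≤-refl (invPow-nonneg k))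
      ... | true  | true  | ofʸ m≤k = begin
        invPow (m ⊔ k)                       ≡⟨ cong invPow (ℕP.m≤n⇒m⊔n≡n m≤k) ⟩
        invPow k                             ≡⟨ ℚP.*-identityˡ (invPow k) ⟨
        1ℚ * invPow k                        ≤⟨ p≤q+p (1ℚ * invPow k) (invPow-nonneg (m ⊔ suc k)) ⟩
        invPow (m ⊔ suc k) + 1ℚ * invPow k   ∎
        where open ℚP.≤-Reasoning
              m = otherLevel lev v e
      ... | true  | false | ofⁿ m≰k = begin
        invPow (m ⊔ k)                       ≡⟨ cong invPow (trans (ℕP.m≥n⇒m⊔n≡m (ℕP.<⇒≤ k<m))
                                                                    (sym (ℕP.m≥n⇒m⊔n≡m k<m))) ⟩
        invPow (m ⊔ suc k)                   ≤⟨ p≤p+q (invPow (m ⊔ suc k)) (*-nonneg ℚP.≤-refl (invPow-nonneg k)) ⟩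
        invPow (m ⊔ suc k) + 0ℚ * invPow k   ∎
        where open ℚP.≤-Reasoning
              m = otherLevel lev v e
              k<m = ℕP.≰⇒> m≰k

    invPow1≤Wto⇒invPow2≤Wto-suc : ∀ (lev : Levels n) E v k →
      invPow 1 ≤ Wto lev E v k → invPow 2 ≤ Wto lev E v (suc k)
    invPow1≤Wto⇒invPow2≤Wto-suc lev E v k invPow1≤ = ℚP.*-cancelˡ-≤-pos (ofℕ β) (begin
      ofℕ β * invPow 2              ≡⟨ β*invPow-suc 1 ⟩
      invPow 1                      ≤⟨ invPow1≤ ⟩
      Wto lev E v k                 ≤⟨ Wto-≤-β*Wto-suc lev E v k ⟩
      ofℕ β * Wto lev E v (suc k)   ∎)
      where open ℚP.≤-Reasoning

  φ : ℕ → ℚ → ℚ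
  φ zero    w = 0ℚ
  φ (suc k) w = powβ (suc k) * [ invPow 2 - w ]⁺

  φ-nonneg : ∀ k w → 0ℚ ≤ φ k w
  φ-nonneg zero    w = ℚP.≤-refl
  φ-nonneg (suc k) w = *-nonneg (powβ-nonneg (suc k)) ([x]⁺-nonneg (invPow 2 - w))

  φ-vanishes : ∀ k {w} → invPow 2 ≤ w → φ k w ≡ 0ℚ
  φ-vanishes zero    _ = refl
  φ-vanishes (suc k) {w} invPow2≤w = begin
    powβ (suc k) * [ invPow 2 - w ]⁺   ≡⟨ cong (powβ (suc k) *_) ([x]⁺≡0 invPow2-w≤0) ⟩
    powβ (suc k) * 0ℚ                  ≡⟨ ℚP.*-zeroʳ (powβ (suc k)) ⟩
    0ℚ                                 ∎
    where open ≡-Reasoning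
          invPow2-w≤0 : invPow 2 - w ≤ 0ℚ
          invPow2-w≤0 = subst (invPow 2 - w ≤_) (ℚP.+-inverseʳ w) (ℚP.+-monoˡ-≤ (- w) invPow2≤w)

  φ-vanishes-≤ : ∀ k {w q} → 0ℚ ≤ q → invPow 2 ≤ w → φ k w ≤ q
  φ-vanishes-≤ k q≥0 invPow2≤w = subst (_≤ _) (sym (φ-vanishes k invPow2≤w)) q≥0

  φ-antitone : ∀ k {w w'} → w ≤ w' → φ k w' ≤ φ k w
  φ-antitone zero    _    = ℚP.≤-refl
  φ-antitone (suc k) w≤w' = *-monoˡ-≤ (powβ-nonneg (suc k))
    ([-]⁺-mono-≤ (ℚP.+-monoʳ-≤ (invPow 2) (ℚP.neg-antimono-≤ w≤w')))

  φ-lipschitz : ∀ k {w w' d} → 0ℚ ≤ d → w ≤ w' + d * invPow k → φ k w' ≤ φ k w + d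
  φ-lipschitz zero    {d = d} d≥0 _ = subst (0ℚ ≤_) (sym (ℚP.+-identityˡ d)) d≥0
  φ-lipschitz (suc k) {w} {w'} {d} d≥0 w≤w'+dI = begin
    P * [ c - w' ]⁺                ≤⟨ *-monoˡ-≤ P≥0 ([-]⁺-mono-≤ shift) ⟩
    P * [ (c - w) + d * I ]⁺       ≤⟨ *-monoˡ-≤ P≥0 ([x+d]⁺≤[x]⁺+d (c - w) (*-nonneg d≥0 (invPow-nonneg (suc k)))) ⟩
    P * ([ c - w ]⁺ + d * I)       ≡⟨ solve 4 (λ p x d i → p :* (x :+ d :* i) := p :* x :+ d :* (p :* i))
                                        refl P [ c - w ]⁺ d I ⟩
    P * [ c - w ]⁺ + d * (P * I)   ≡⟨ cong (λ x → P * [ c - w ]⁺ + d * x) (powβ*invPow (suc k)) ⟩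
    P * [ c - w ]⁺ + d * 1ℚ        ≡⟨ cong (λ x → P * [ c - w ]⁺ + x) (ℚP.*-identityʳ d) ⟩
    P * [ c - w ]⁺ + d             ∎
    where
    open ℚP.≤-Reasoning
    open ℚ-Solver.+-*-Solver
    P = powβ (suc k)
    I = invPow (suc k)
    c = invPow 2
    P≥0 : 0ℚ ≤ P
    P≥0 = powβ-nonneg (suc k)
    shift : c - w' ≤ (c - w) + d * I
    shift = begin
      c - w'                       ≡⟨ solve 4 (λ c w' d i → c :- w' := (c :- (w' :+ d :* i)) :+ d :* i)
                                        refl c w' d I ⟩
      (c - (w' + d * I)) + d * I   ≤⟨ ℚP.+-monoˡ-≤ (d * I) (ℚP.+-monoʳ-≤ c (ℚP.neg-antimono-≤ w≤w'+dI)) ⟩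
      (c - w) + d * I              ∎

  φ-1-≤-1 : ∀ {w} → 0ℚ ≤ w → φ 1 w ≤ 1ℚ
  φ-1-≤-1 w≥0 = ℚP.≤-trans (*-monoˡ-≤ (ofℕ-nonneg β) ([-]⁺-mono-≤ (p-q≤p (invPow 2) w≥0)))
    (toWitness {a? = powβ 1 * [ invPow 2 ]⁺ ℚP.≤? 1ℚ} _)

  φ-1-≤-ofℕ : ∀ c {w₀ w} → invPow 2 < w₀ → w₀ ≤ w + ofℕ c * invPow 0 → 0ℚ ≤ w → φ 1 w ≤ ofℕ c
  φ-1-≤-ofℕ zero    {w₀} {w} invPow2<w₀ w₀≤w+0 _ =
    ℚP.≤-reflexive (φ-vanishes 1 (ℚP.<⇒≤ (ℚP.<-≤-trans invPow2<w₀
      (subst (w₀ ≤_) (ℚP.+-identityʳ w) w₀≤w+0))))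
  φ-1-≤-ofℕ (suc c) _ _ w≥0 = ℚP.≤-trans (φ-1-≤-1 w≥0) (ofℕ-mono-≤ {1} {suc c} (s≤s z≤n))

  downIncrement : ℕ → ℕ → ℚ
  downIncrement f k = (powβ k * invPow 2) * invα f

  α∸1*downIncrement≤φ : ∀ f k {w} → 0 ℕ.< k → w ≤ invα f * invPow 2 →
    ofℕ (α∸1 f) * downIncrement f k ≤ φ k w
  α∸1*downIncrement≤φ f (suc k) {w} _ w≤ = begin
    D * ((P * c) * a)    ≡⟨ solve 4 (λ D p c a → D :* ((p :* c) :* a) := p :* (c :* (D :* a))) refl D P c a ⟩
    P * (c * (D * a))    ≡⟨ cong (λ x → P * (c * x)) (α∸1*invα f) ⟩
    P * (c * (1ℚ - a))   ≡⟨ cong (P *_) (solve 2 (λ c a → c :* (con 1ℚ :- a) := c :- a :* c) refl c a) ⟩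
    P * (c - a * c)      ≤⟨ *-monoˡ-≤ (powβ-nonneg (suc k))
                              (ℚP.≤-trans (ℚP.+-monoʳ-≤ c (ℚP.neg-antimono-≤ w≤)) (x≤[x]⁺ (c - w))) ⟩
    P * [ c - w ]⁺       ∎
    where
    open ℚP.≤-Reasoning
    open ℚ-Solver.+-*-Solver
    D = ofℕ (α∸1 f)
    P = powβ (suc k)
    c = invPow 2
    a = invα f

  module _ {n : ℕ} where

    φ-setLevel-self : ∀ (lev : Levels n) E v j →
      φ (setLevel lev v j v) (W (setLevel lev v j) E v) ≡ φ j (Wto lev E v j)
    φ-setLevel-self lev E v j = cong₂ φ (setLevel-self lev v j) (W-setLevel-self lev E v j)

    -- Minimality of j, or for j = ℓ(v) + 1 the dirtiness of v, gives W_{v→j−1} ≥ 1/β and hence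
    -- W_{v→j} ≥ 1/β², except for a jump from level 0 to level 1, where the counted hyperedges pay.
    φ-upTarget≤countLE : ∀ (lev : Levels n) E v {j L} → UpDirty lev E v → UpTarget L lev E v j →
      φ j (Wto lev E v j) ≤ ofℕ (countLE lev E v (j ∸ 1))
    φ-upTarget≤countLE lev E v {suc i} dirty (s≤s lv≤i , _ , _ , minimal) with ℕP.m≤n⇒m<n∨m≡n lv≤i
    ... | inj₁ lv<i = φ-vanishes-≤ (suc i) (ofℕ-nonneg (countLE lev E v i))
      (invPow1≤Wto⇒invPow2≤Wto-suc lev E v i (ℚP.<⇒≤ (ℚP.≰⇒> (minimal i lv<i ℕP.≤-refl))))
    ... | inj₂ refl with dirty
    ...   | inj₂ (_ , 1≤W) = φ-vanishes-≤ (suc i) (ofℕ-nonneg (countLE lev E v i))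
      (invPow1≤Wto⇒invPow2≤Wto-suc lev E v i
        (ℚP.≤-trans (toWitness {a? = invPow 1 ℚP.≤? 1ℚ} _) (subst (1ℚ ≤_) (W≡Wto-level lev E v) 1≤W)))
    ...   | inj₁ (lv≡0 , invPow2<W) rewrite lv≡0 = φ-1-≤-ofℕ (countLE lev E v 0)
      (subst (invPow 2 <_) (trans (W≡Wto-level lev E v) (cong (Wto lev E v) lv≡0)) invPow2<W)
      (Wto-≤-Wto-suc+countLE lev E v 0) (Wto-nonneg lev E v 1)

    downTarget-≤ : ∀ (lev : Levels n) E v {j} → DownTarget lev E v j → j ℕ.≤ lev v
    downTarget-≤ lev E v (inj₁ (_ , j<lv , _)) = ℕP.<⇒≤ j<lv
    downTarget-≤ lev E v (inj₂ (refl , _))     = z≤n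

    φ-downTarget≡0 : ∀ (lev : Levels n) E v {j} → DownTarget lev E v j → φ j (Wto lev E v j) ≡ 0ℚ
    φ-downTarget≡0 lev E v {j} (inj₁ (_ , _ , invPow2<W , _)) = φ-vanishes j (ℚP.<⇒≤ invPow2<W)
    φ-downTarget≡0 lev E v     (inj₂ (refl , _))              = refl

    Φ : Levels n → List (Edge n) → ℚ
    Φ lev E = sum (λ u → φ (lev u) (W lev E u))

    Φ-nonneg : ∀ (lev : Levels n) E → 0ℚ ≤ Φ lev E
    Φ-nonneg lev E = sum-nonneg (λ u → φ-nonneg (lev u) (W lev E u))

    Φ-insert : ∀ (lev : Levels n) E e → Φ lev (e ∷ E) ≤ Φ lev E
    Φ-insert lev E e = sum-mono-≤ (λ u → φ-antitone (lev u) (p≤q+p (W lev E u) (edgeWeight-nonneg lev u e)))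

    Φ-delete : ∀ (lev : Levels n) xs e ys → Φ lev (xs ++ ys) ≤ Φ lev (xs ++ e ∷ ys) + ofℕ ∣ e ∣
    Φ-delete lev xs e ys = subst (Φ lev (xs ++ ys) ≤_) (cong (Φ lev (xs ++ e ∷ ys) +_) (sum-𝟙 e))
      (sum-≤-+ (λ u → φ-lipschitz (lev u) (𝟙-nonneg (lookup e u)) (weight-drop u)))
      where
      weight-drop : ∀ u → W lev (xs ++ e ∷ ys) u ≤ W lev (xs ++ ys) u + 𝟙 (lookup e u) * invPow (lev u)
      weight-drop u = begin
        W lev (xs ++ e ∷ ys) u                                 ≡⟨ sumℚ-map-++-∷ (edgeWeight lev u) xs e ys ⟩
        edgeWeight lev u e + W lev (xs ++ ys) u                ≤⟨ ℚP.+-monoˡ-≤ _ (edgeWeight-≤-𝟙*invPow lev u e) ⟩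
        𝟙 (lookup e u) * invPow (lev u) + W lev (xs ++ ys) u   ≡⟨ ℚP.+-comm _ (W lev (xs ++ ys) u) ⟩
        W lev (xs ++ ys) u + 𝟙 (lookup e u) * invPow (lev u)   ∎
        where open ℚP.≤-Reasoning

    Φ-upJump : ∀ f (lev : Levels n) E v {j L} → UpDirty lev E v → UpTarget L lev E v j →
      All (λ e → ∣ e ∣ ℕ.≤ f) E → Φ (setLevel lev v j) E ≤ Φ lev E + ofℕ (countLE lev E v (j ∸ 1)) * ofℕ f
    Φ-upJump f lev E v {j} dirty target small = begin
      Φ lev' E                                                             ≤⟨ sum-≤-+ node-bound ⟩
      Φ lev E + sum (λ u → sumℚ (map (λ e → 𝟙 (lookup e u ∧ low e)) E))
        ≡⟨ cong (Φ lev E +_) (sum-sumℚ-comm (λ u e → 𝟙 (lookup e u ∧ low e)) E) ⟩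
      Φ lev E + sumℚ (map (λ e → sum (λ u → 𝟙 (lookup e u ∧ low e))) E)
        ≤⟨ ℚP.+-monoʳ-≤ (Φ lev E) (sumℚ-map-mono-≤ (All.map (λ {e} → edge-bound e) small)) ⟩
      Φ lev E + sumℚ (map (λ e → 𝟙 (low e) * ofℕ f) E)
        ≡⟨ cong (Φ lev E +_) (trans (sumℚ-map-*ʳ (ofℕ f) (𝟙 ∘ low) E)
                                    (cong (_* ofℕ f) (sym (ofℕ-countLE lev E v (j ∸ 1))))) ⟩
      Φ lev E + ofℕ (countLE lev E v (j ∸ 1)) * ofℕ f                       ∎
      where
      open ℚP.≤-Reasoning
      lev' = setLevel lev v j
      low = isLow lev v (j ∸ 1)
      lowEdgesAt : Fin n → ℚ
      lowEdgesAt u = sumℚ (map (λ e → 𝟙 (lookup e u ∧ low e)) E)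
      edge-bound : ∀ e → ∣ e ∣ ℕ.≤ f → sum (λ u → 𝟙 (lookup e u ∧ low e)) ≤ 𝟙 (low e) * ofℕ f
      edge-bound e ∣e∣≤f = begin
        sum (λ u → 𝟙 (lookup e u ∧ low e))   ≡⟨ sum-𝟙-∧ e (low e) ⟩
        ofℕ ∣ e ∣ * 𝟙 (low e)                ≤⟨ *-monoʳ-≤ (𝟙-nonneg (low e)) (ofℕ-mono-≤ ∣e∣≤f) ⟩
        ofℕ f * 𝟙 (low e)                    ≡⟨ ℚP.*-comm (ofℕ f) (𝟙 (low e)) ⟩
        𝟙 (low e) * ofℕ f                    ∎
      countLE≡lowEdgesAt-v : ofℕ (countLE lev E v (j ∸ 1)) ≡ lowEdgesAt v
      countLE≡lowEdgesAt-v = trans (ofℕ-countLE lev E v (j ∸ 1))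
        (cong sumℚ (map-cong (λ e → cong 𝟙 (∧-repeat (lookup e v) _)) E))
      node-bound : ∀ u → φ (lev' u) (W lev' E u) ≤ φ (lev u) (W lev E u) + lowEdgesAt u
      node-bound u = by-cases u (u Fin.≟ v)
        where
        by-cases : ∀ u → Dec (u ≡ v) → φ (lev' u) (W lev' E u) ≤ φ (lev u) (W lev E u) + lowEdgesAt u
        by-cases u (no u≢v) = begin
          φ (lev' u) (W lev' E u)                ≡⟨ cong (λ k → φ k (W lev' E u)) (setLevel-other lev v j u≢v) ⟩
          φ (lev u) (W lev' E u)                 ≤⟨ φ-lipschitz (lev u) (sumℚ-map-nonneg E (λ e → 𝟙-nonneg (lookup e u ∧ low e)))
                                                      (W-upJump lev E v u (proj₁ target)) ⟩
          φ (lev u) (W lev E u) + lowEdgesAt u   ∎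
        by-cases u (yes refl) = begin
          φ (lev' u) (W lev' E u)                ≡⟨ φ-setLevel-self lev E u j ⟩
          φ j (Wto lev E u j)                    ≤⟨ φ-upTarget≤countLE lev E u dirty target ⟩
          ofℕ (countLE lev E u (j ∸ 1))          ≡⟨ countLE≡lowEdgesAt-v ⟩
          lowEdgesAt u                           ≤⟨ p≤q+p (lowEdgesAt u) (φ-nonneg (lev u) (W lev E u)) ⟩
          φ (lev u) (W lev E u) + lowEdgesAt u   ∎

    Φ-downJump : ∀ f (lev : Levels n) E v {j} → DownDirty f lev E v → DownTarget lev E v j →
      Φ (setLevel lev v j) E + ofℕ (α∸1 f) * downIncrement f (lev v) ≤ Φ lev E
    Φ-downJump f lev E v {j} (0<lv , W≤) target = sum-+-≤-except v node-bound self-bound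
      where
      lev' = setLevel lev v j
      increment = ofℕ (α∸1 f) * downIncrement f (lev v)
      node-bound : ∀ u → u ≢ v → φ (lev' u) (W lev' E u) ≤ φ (lev u) (W lev E u)
      node-bound u u≢v = subst (λ k → φ k (W lev' E u) ≤ φ (lev u) (W lev E u)) (sym (setLevel-other lev v j u≢v))
        (φ-antitone (lev u) (W-antitone {lev = lev} {lev' = lev'} E u (setLevel-≤ lev v (downTarget-≤ lev E v target))))
      self-bound : φ (lev' v) (W lev' E v) + increment ≤ φ (lev v) (W lev E v)
      self-bound = begin
        φ (lev' v) (W lev' E v) + increment
          ≡⟨ cong (_+ increment) (trans (φ-setLevel-self lev E v j) (φ-downTarget≡0 lev E v target)) ⟩
        0ℚ + increment          ≡⟨ ℚP.+-identityˡ increment ⟩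
        increment               ≤⟨ α∸1*downIncrement≤φ f (lev v) 0<lv W≤ ⟩
        φ (lev v) (W lev E v)   ∎
        where open ℚP.≤-Reasoning

  Invariant : ∀ {n} → ℕ → State n → Set
  Invariant f s = All (λ e → ∣ e ∣ ℕ.≤ f) (edges s)
                × ofℕ (α∸1 f) * Idown s + Φ (lev s) (edges s) ≤ ofℕ (T s ℕ.+ Cup s) * ofℕ f

  invariant-init : ∀ n f → Invariant f (initState n)
  invariant-init n f = [] , ℚP.≤-reflexive (begin
    ofℕ (α∸1 f) * 0ℚ + sum {n} (λ _ → 0ℚ)   ≡⟨ cong₂ _+_ (ℚP.*-zeroʳ (ofℕ (α∸1 f))) (sum-replicate-zero n) ⟩
    0ℚ                                      ≡⟨ ℚP.*-zeroˡ (ofℕ f) ⟨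
    0ℚ * ofℕ f                              ∎)
    where open ≡-Reasoning

  invariant-step : ∀ {n f} {s s' : State n} → Step n f s s' → Invariant f s → Invariant f s'
  invariant-step {f = f} (insert {l} {E} {t} {cu} {_} {id} e _ _ ∣e∣≤f _) (small , bound) =
    ∣e∣≤f ∷ small , (begin
      ofℕ (α∸1 f) * id + Φ l (e ∷ E)   ≤⟨ ℚP.+-monoʳ-≤ (ofℕ (α∸1 f) * id) (Φ-insert l E e) ⟩
      ofℕ (α∸1 f) * id + Φ l E         ≤⟨ bound ⟩
      ofℕ (t ℕ.+ cu) * ofℕ f           ≤⟨ *-monoʳ-≤ (ofℕ-nonneg f) (ofℕ-mono-≤ (ℕP.n≤1+n (t ℕ.+ cu))) ⟩
      ofℕ (suc t ℕ.+ cu) * ofℕ f       ∎)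
    where open ℚP.≤-Reasoning
  invariant-step {f = f} (delete {l} {t} {cu} {_} {id} xs ys e _) (small , bound)
    with AllP.++⁻ xs small
  ... | small-xs , ∣e∣≤f ∷ small-ys = AllP.++⁺ small-xs small-ys , (begin
      ofℕ (α∸1 f) * id + Φ l (xs ++ ys)    ≤⟨ ≤-transfer (ofℕ (α∸1 f) * id) (Φ-delete l xs e ys) bound ⟩
      ofℕ (t ℕ.+ cu) * ofℕ f + ofℕ ∣ e ∣   ≤⟨ ℚP.+-monoʳ-≤ (ofℕ (t ℕ.+ cu) * ofℕ f) (ofℕ-mono-≤ ∣e∣≤f) ⟩
      ofℕ (t ℕ.+ cu) * ofℕ f + ofℕ f       ≡⟨ solve 2 (λ N F → N :* F :+ F := (con 1ℚ :+ N) :* F)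
                                                refl (ofℕ (t ℕ.+ cu)) (ofℕ f) ⟩
      (1ℚ + ofℕ (t ℕ.+ cu)) * ofℕ f        ≡⟨ cong (_* ofℕ f) (ofℕ-+ 1 (t ℕ.+ cu)) ⟨
      ofℕ (suc t ℕ.+ cu) * ofℕ f           ∎)
    where open ℚP.≤-Reasoning
          open ℚ-Solver.+-*-Solver
  invariant-step {f = f} (upJump {l} {E} {t} {cu} {_} {id} v j dirty target) (small , bound) =
    small , (begin
      ofℕ (α∸1 f) * id + Φ (setLevel l v j) E   ≤⟨ ≤-transfer (ofℕ (α∸1 f) * id) (Φ-upJump f l E v dirty target small) bound ⟩
      ofℕ (t ℕ.+ cu) * ofℕ f + ofℕ c * ofℕ f    ≡⟨ ℚP.*-distribʳ-+ (ofℕ f) (ofℕ (t ℕ.+ cu)) (ofℕ c) ⟨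
      (ofℕ (t ℕ.+ cu) + ofℕ c) * ofℕ f          ≡⟨ cong (_* ofℕ f) (ofℕ-+ (t ℕ.+ cu) c) ⟨
      ofℕ ((t ℕ.+ cu) ℕ.+ c) * ofℕ f            ≡⟨ cong (λ N → ofℕ N * ofℕ f) (ℕP.+-assoc t cu c) ⟩
      ofℕ (t ℕ.+ (cu ℕ.+ c)) * ofℕ f            ∎)
    where open ℚP.≤-Reasoning
          c = countLE l E v (j ∸ 1)
  invariant-step {f = f} (downJump {l} {E} {t} {cu} {_} {id} v j _ dirty target) (small , bound) =
    small , (begin
      D * (id + x) + Φ (setLevel l v j) E       ≡⟨ solve 4 (λ D i x p → D :* (i :+ x) :+ p := D :* i :+ (p :+ D :* x))
                                                     refl D id x (Φ (setLevel l v j) E) ⟩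
      D * id + (Φ (setLevel l v j) E + D * x)   ≤⟨ ℚP.+-monoʳ-≤ (D * id) (Φ-downJump f l E v dirty target) ⟩
      D * id + Φ l E                            ≤⟨ bound ⟩
      ofℕ (t ℕ.+ cu) * ofℕ f                    ∎)
    where open ℚP.≤-Reasoning
          open ℚ-Solver.+-*-Solver
          D = ofℕ (α∸1 f)
          x = downIncrement f (l v)

  invariant-star : ∀ {n f} {s s' : State n} → Star (Step n f) s s' → Invariant f s → Invariant f s'
  invariant-star ε              inv = inv
  invariant-star (step ◅ steps) inv = invariant-star steps (invariant-step step inv)

open import Data.Nat using (ℕ; suc; _+_) renaming (_≤_ to _≤ℕ_)
open import Data.Product using (proj₂)
open import Data.Rational using (_≤_; _*_)
open import Relation.Binary.Construct.Closure.ReflexiveTransitive using (Star)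
open Potential using (α∸1*p+q≤r*f⇒p≤fOverαm1*r; Φ-nonneg; invariant-init; invariant-star)

-- The invariant holds after every step.
lemma5 : (n f : ℕ) → 1 ≤ℕ f → (s : State n) → Star (Step n f) (initState n) s → Clean f s → Idown s ≤ fOverαm1 f * ofℕ (T s + Cup s)
lemma5 n (suc k) _ s run _ = α∸1*p+q≤r*f⇒p≤fOverαm1*r k (T s + Cup s) (Φ-nonneg (lev s) (edges s))
  (proj₂ (invariant-star run (invariant-init n (suc k))))
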